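{- The equation $15x^2 + 49^{2y} = 2^{z+2}$ has no solution in positive integers $x,y,z$. -}

-- Modulo 5 the equation reads 2 ^ (z + 2) ≡ 1, so z + 2 = 4q and, writing P = 4 ^ q and
-- Q = 49 ^ y, it becomes (P + Q)(P - Q) = 15 x². The factors are coprime (their gcd divides
-- 2 gcd(P, Q) = 2 and P + Q is odd), so P + Q = d g² with d ∣ 15. But P + Q ≡ 16 + 1 = 17
-- (mod 24), and no number of the form d g² with d ∣ 15 is 17 modulo 24.
module Submission where

open import Data.Nat
  using (ℕ; zero; suc; _+_; _*_; _^_; _∸_; _%_; _/_; _≤_; _<_; _≥_; _≟_; _<?_; s≤s;
         NonZero; ≢-nonZero; ≢-nonZero⁻¹)
open import Data.Nat.Properties
open import Data.Nat.DivMod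
open import Data.Nat.Divisibility
open import Data.Nat.GCD
  using (gcd; gcd[m,n]∣m; gcd[m,n]∣n; gcd-greatest; gcd[m,n]≢0; c*gcd[m,n]≡gcd[cm,cn])
open import Data.Nat.Coprimality
  using (Coprime; coprime-divisor; coprime-/gcd; coprime⇒gcd≡1; gcd≡1⇒coprime; 1-coprimeTo)
import Data.Nat.Coprimality as Coprime
open import Data.Nat.Primality using (irreducible[2])
open import Data.Nat.Tactic.RingSolver using (solve-∀)
open import Data.Product using (_×_; _,_; ∃₂)
open import Data.Sum using (inj₁; inj₂)
open import Function using (case_of_)
open import Data.Unit using (tt)
open import Relation.Binary.PropositionalEquality
open import Relation.Nullary using (¬_; contradiction)
open import Relation.Nullary.Decidable using (toWitness; ¬?; _→-dec_)

%-cong-* : ∀ {a a′ b b′} n .{{_ : NonZero n}} →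
           a % n ≡ a′ % n → b % n ≡ b′ % n → a * b % n ≡ a′ * b′ % n
%-cong-* {a} {a′} {b} {b′} n a≡a′ b≡b′ = begin
  a * b % n               ≡⟨ %-distribˡ-* a b n ⟩
  (a % n) * (b % n) % n   ≡⟨ cong₂ (λ u v → u * v % n) a≡a′ b≡b′ ⟩
  (a′ % n) * (b′ % n) % n ≡⟨ %-distribˡ-* a′ b′ n ⟨
  a′ * b′ % n             ∎
  where open ≡-Reasoning

m%n≡1⇒m^k%n≡1 : ∀ {m n} .{{_ : NonZero n}} → m % n ≡ 1 → ∀ k → m ^ k % n ≡ 1
m%n≡1⇒m^k%n≡1 {m} {n} m%n≡1 zero =
  trans (cong (_% n) (sym m%n≡1)) (trans (m%n%n≡m%n m n) m%n≡1)
m%n≡1⇒m^k%n≡1 {m} {n} m%n≡1 (suc k) = begin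
  m * m ^ k % n ≡⟨ %-cong-* n (trans m%n≡1 1≡1%n) (trans (m%n≡1⇒m^k%n≡1 m%n≡1 k) 1≡1%n) ⟩
  1 % n         ≡⟨ 1%n≡1 ⟩
  1             ∎
  where
  open ≡-Reasoning
  1%n≡1 : 1 % n ≡ 1
  1%n≡1 = m%n≡1⇒m^k%n≡1 m%n≡1 zero
  1≡1%n : 1 ≡ 1 % n
  1≡1%n = sym 1%n≡1

2^[4+n]%5≡2^n%5 : ∀ n → 2 ^ (4 + n) % 5 ≡ 2 ^ n % 5
2^[4+n]%5≡2^n%5 n =
  trans (cong (_% 5) (16*m≡m+3m*5 (2 ^ n))) ([m+kn]%n≡m%n (2 ^ n) (3 * 2 ^ n) 5)
  where
  16*m≡m+3m*5 : ∀ m → 2 * (2 * (2 * (2 * m))) ≡ m + 3 * m * 5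
  16*m≡m+3m*5 = solve-∀

2^n%5≡1⇒4∣n : ∀ n → 2 ^ n % 5 ≡ 1 → 4 ∣ n
2^n%5≡1⇒4∣n 0 _ = 4 ∣0
2^n%5≡1⇒4∣n 1 ()
2^n%5≡1⇒4∣n 2 ()
2^n%5≡1⇒4∣n 3 ()
2^n%5≡1⇒4∣n (suc (suc (suc (suc n)))) 2^[4+n]%5≡1 =
  ∣m∣n⇒∣m+n ∣-refl (2^n%5≡1⇒4∣n n (trans (sym (2^[4+n]%5≡2^n%5 n)) 2^[4+n]%5≡1))

4^[2+k]%24≡16 : ∀ k → 4 ^ (2 + k) % 24 ≡ 16
4^[2+k]%24≡16 zero    = refl
4^[2+k]%24≡16 (suc k) = %-cong-* {4} {4} {4 ^ (2 + k)} {16} 24 refl (4^[2+k]%24≡16 k)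

coprime-*ˡ : ∀ {a b n} → Coprime a n → Coprime b n → Coprime (a * b) n
coprime-*ˡ {a} {b} {n} a⊥n b⊥n {d} (d∣ab , d∣n) = b⊥n (d∣b , d∣n)
  where
  d⊥a : Coprime d a
  d⊥a (e∣d , e∣a) = a⊥n (e∣a , ∣-trans e∣d d∣n)
  d∣b : d ∣ b
  d∣b = coprime-divisor d⊥a d∣ab

coprime-^ˡ : ∀ {m n} → Coprime m n → ∀ k → Coprime (m ^ k) n
coprime-^ˡ {n = n} m⊥n zero    = 1-coprimeTo n
coprime-^ˡ         m⊥n (suc k) = coprime-*ˡ m⊥n (coprime-^ˡ m⊥n k)

coprime-^ : ∀ {m n} → Coprime m n → ∀ j k → Coprime (m ^ j) (n ^ k)
coprime-^ m⊥n j k = coprime-^ˡ (Coprime.sym (coprime-^ˡ (Coprime.sym m⊥n) k)) j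

m*m≤n*n⇒m≤n : ∀ {m n} → m * m ≤ n * n → m ≤ n
m*m≤n*n⇒m≤n mm≤nn = ≮⇒≥ (λ n<m → <⇒≱ (*-mono-< n<m n<m) mm≤nn)

∣odd∧∣2⇒≡1 : ∀ {d m} → m % 2 ≡ 1 → d ∣ m → d ∣ 2 → d ≡ 1
∣odd∧∣2⇒≡1 {m = m} odd d∣m d∣2 with irreducible[2] d∣2
... | inj₁ d≡1  = d≡1
... | inj₂ refl = contradiction (trans (sym (n∣m⇒m%n≡0 m 2 d∣m)) odd) 0≢1+n

-- Common divisors of P + Q and P - Q divide 2P and 2Q, hence 2 gcd(P, Q) = 2.
coprime-sum-difference : ∀ {P Q B} → Coprime P Q → (P + Q) % 2 ≡ 1 → Q + B ≡ P →
                         Coprime (P + Q) B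
coprime-sum-difference {Q = Q} {B} P⊥Q odd refl {d} (d∣P+Q , d∣B) =
  ∣odd∧∣2⇒≡1 odd d∣P+Q d∣2
  where
  P = Q + B
  sum+difference : ∀ Q B → Q + B + Q + B ≡ 2 * (Q + B)
  sum+difference = solve-∀
  sum≡difference+2Q : ∀ Q B → Q + B + Q ≡ B + 2 * Q
  sum≡difference+2Q = solve-∀
  d∣2P : d ∣ 2 * P
  d∣2P = subst (d ∣_) (sum+difference Q B) (∣m∣n⇒∣m+n d∣P+Q d∣B)
  d∣2Q : d ∣ 2 * Q
  d∣2Q = ∣m+n∣m⇒∣n (subst (d ∣_) (sum≡difference+2Q Q B) d∣P+Q) d∣B
  gcd[2P,2Q]≡2 : gcd (2 * P) (2 * Q) ≡ 2
  gcd[2P,2Q]≡2 = trans (sym (c*gcd[m,n]≡gcd[cm,cn] 2 P Q)) (cong (2 *_) (coprime⇒gcd≡1 P⊥Q))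
  d∣2 : d ∣ 2
  d∣2 = subst (d ∣_) gcd[2P,2Q]≡2 (gcd-greatest d∣2P d∣2Q)

coprime-∣c*square⇒∣c : ∀ {e c x} → Coprime e x → e ∣ c * (x * x) → e ∣ c
coprime-∣c*square⇒∣c {e} {c} {x} e⊥x e∣cxx =
  coprime-divisor e⊥x (coprime-divisor e⊥x (subst (e ∣_) (reorder c x) e∣cxx))
  where
  reorder : ∀ c x → c * (x * x) ≡ x * (x * c)
  reorder = solve-∀

-- Write g = gcd A x, A = a g, x = x′ g. Then a B = c x′² g, and g is prime to B, so g ∣ a;
-- with a = d g we get d B = c x′², and d is prime to x′, so d ∣ c.
coprime-factor≡divisor*square : ∀ c {A B} x .{{_ : NonZero A}} → Coprime A B →
                                A * B ≡ c * (x * x) →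
                                ∃₂ λ d g → d ∣ c × A ≡ d * (g * g)
coprime-factor≡divisor*square c {A} {B} x A⊥B AB≡cxx = d , g , d∣c , A≡dgg
  where
  open ≡-Reasoning
  g = gcd A x
  instance
    g≢0 : NonZero g
    g≢0 = ≢-nonZero (gcd[m,n]≢0 A x (inj₁ (≢-nonZero⁻¹ A)))
  a = A / g
  x′ = x / g
  A≡ag : A ≡ a * g
  A≡ag = sym (m/n*n≡m (gcd[m,n]∣m A x))
  x≡x′g : x ≡ x′ * g
  x≡x′g = sym (m/n*n≡m (gcd[m,n]∣n A x))
  aB≡cx′x′g : a * B ≡ c * (x′ * x′) * g
  aB≡cx′x′g = *-cancelʳ-≡ _ _ g (begin
    a * B * g               ≡⟨ *-comm-middle a B g ⟩
    a * g * B               ≡⟨ cong (_* B) A≡ag ⟨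
    A * B                   ≡⟨ AB≡cxx ⟩
    c * (x * x)             ≡⟨ cong (λ u → c * (u * u)) x≡x′g ⟩
    c * (x′ * g * (x′ * g)) ≡⟨ regroup c x′ g ⟩
    c * (x′ * x′) * g * g   ∎)
    where
    *-comm-middle : ∀ a b g → a * b * g ≡ a * g * b
    *-comm-middle = solve-∀
    regroup : ∀ c x′ g → c * (x′ * g * (x′ * g)) ≡ c * (x′ * x′) * g * g
    regroup = solve-∀
  g⊥B : Coprime g B
  g⊥B (e∣g , e∣B) = A⊥B (∣-trans e∣g (gcd[m,n]∣m A x) , e∣B)
  g∣a : g ∣ a
  g∣a = coprime-divisor g⊥B (divides (c * (x′ * x′)) (trans (*-comm B a) aB≡cx′x′g))
  d = quotient g∣a
  a≡dg : a ≡ d * g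
  a≡dg = m∣n⇒n≡quotient*m g∣a
  dB≡cx′x′ : d * B ≡ c * (x′ * x′)
  dB≡cx′x′ = *-cancelʳ-≡ _ _ g (begin
    d * B * g     ≡⟨ trans (*-assoc d B g) (cong (d *_) (*-comm B g)) ⟩
    d * (g * B)   ≡⟨ sym (*-assoc d g B) ⟩
    d * g * B     ≡⟨ cong (_* B) a≡dg ⟨
    a * B         ≡⟨ aB≡cx′x′g ⟩
    c * (x′ * x′) * g ∎)
  d⊥x′ : Coprime d x′
  d⊥x′ (e∣d , e∣x′) =
    coprime-/gcd A x (∣-trans e∣d (divides g (trans a≡dg (*-comm d g))) , e∣x′)
  d∣c : d ∣ c
  d∣c = coprime-∣c*square⇒∣c d⊥x′ (divides B (trans (sym dB≡cx′x′) (*-comm d B)))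
  A≡dgg : A ≡ d * (g * g)
  A≡dgg = trans A≡ag (trans (cong (_* g) a≡dg) (*-assoc d g g))

d∣15⇒d*g²%24≢17 : ∀ {d} g → d ∣ 15 → d * (g * g) % 24 ≢ 17
d∣15⇒d*g²%24≢17 {d} g d∣15 ≡17 =
  residues (s≤s (∣⇒≤ d∣15)) (m%n<n g 24) d∣15 (trans (sym reduce) ≡17)
  where
  residues : ∀ {d} → d < 16 → ∀ {r} → r < 24 → d ∣ 15 → d * (r * r) % 24 ≢ 17
  residues = toWitness {a? = allUpTo? (λ d → allUpTo? (λ r →
    (d ∣? 15) →-dec ¬? (d * (r * r) % 24 ≟ 17)) 24) 16} tt
  r = g % 24
  g≡r : g % 24 ≡ r % 24
  g≡r = sym (m%n%n≡m%n g 24)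
  reduce : d * (g * g) % 24 ≡ d * (r * r) % 24
  reduce = %-cong-* {d} {d} {g * g} {r * r} 24 refl (%-cong-* {g} {r} {g} {r} 24 g≡r g≡r)

square-difference : ∀ {P Q B} → Q + B ≡ P → P * P ≡ (P + Q) * B + Q * Q
square-difference {Q = Q} {B} refl = expand Q B
  where
  expand : ∀ Q B → (Q + B) * (Q + B) ≡ (Q + B + Q) * B + Q * Q
  expand = solve-∀

15x²+Q²≢P² : ∀ x {P Q} → Coprime P Q → P % 24 ≡ 16 → Q % 24 ≡ 1 →
             15 * (x * x) + Q * Q ≢ P * P
15x²+Q²≢P² x {P} {Q} P⊥Q P%24≡16 Q%24≡1 eq =
  case coprime-factor≡divisor*square 15 x sum⊥difference product of λ where
    (d , g , d∣15 , P+Q≡dg²) →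
      d∣15⇒d*g²%24≢17 g d∣15 (trans (cong (_% 24) (sym P+Q≡dg²)) sum%24≡17)
  where
  sum%24≡17 : (P + Q) % 24 ≡ 17
  sum%24≡17 = trans (%-distribˡ-+ P Q 24) (cong₂ (λ u v → (u + v) % 24) P%24≡16 Q%24≡1)
  instance
    sum≢0 : NonZero (P + Q)
    sum≢0 = ≢-nonZero λ P+Q≡0 →
      contradiction (trans (cong (_% 24) (sym P+Q≡0)) sum%24≡17) λ ()
  sum-odd : (P + Q) % 2 ≡ 1
  sum-odd =
    trans (sym (m∣n⇒o%n%m≡o%m 2 24 (P + Q) (divides 12 refl))) (cong (_% 2) sum%24≡17)
  Q+[P∸Q]≡P : Q + (P ∸ Q) ≡ P
  Q+[P∸Q]≡P =
    m+[n∸m]≡n (m*m≤n*n⇒m≤n {Q} {P} (subst (Q * Q ≤_) eq (m≤n+m _ (15 * (x * x)))))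
  sum⊥difference : Coprime (P + Q) (P ∸ Q)
  sum⊥difference = coprime-sum-difference P⊥Q sum-odd Q+[P∸Q]≡P
  product : (P + Q) * (P ∸ Q) ≡ 15 * (x * x)
  product = +-cancelʳ-≡ (Q * Q) _ _ (trans (sym (square-difference Q+[P∸Q]≡P)) (sym eq))

m^[2n]≡m^n*m^n : ∀ m n → m ^ (2 * n) ≡ m ^ n * m ^ n
m^[2n]≡m^n*m^n m n = trans (cong (λ k → m ^ (n + k)) (+-identityʳ n)) (^-distribˡ-+-* m n n)

2^[n*4]≡4^n*4^n : ∀ n → 2 ^ (n * 4) ≡ 4 ^ n * 4 ^ n
2^[n*4]≡4^n*4^n n = begin
  2 ^ (n * 4)       ≡⟨ cong (2 ^_) (trans (*-comm n 4) (*-assoc 2 2 n)) ⟩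
  2 ^ (2 * (2 * n)) ≡⟨ ^-*-assoc 2 2 (2 * n) ⟨
  4 ^ (2 * n)       ≡⟨ m^[2n]≡m^n*m^n 4 n ⟩
  4 ^ n * 4 ^ n     ∎
  where open ≡-Reasoning

15x²+49^[2y]≡2^n⇒4∣n : ∀ x y n → 15 * x ^ 2 + 49 ^ (2 * y) ≡ 2 ^ n → 4 ∣ n
15x²+49^[2y]≡2^n⇒4∣n x y n eq = 2^n%5≡1⇒4∣n n (begin
  2 ^ n % 5                        ≡⟨ cong (_% 5) eq ⟨
  (15 * x ^ 2 + 49 ^ (2 * y)) % 5  ≡⟨ %-remove-+ˡ _ (∣m⇒∣m*n (x ^ 2) (divides 3 refl)) ⟩
  49 ^ (2 * y) % 5                 ≡⟨ cong (_% 5) (^-*-assoc 49 2 y) ⟨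
  2401 ^ y % 5                     ≡⟨ m%n≡1⇒m^k%n≡1 refl y ⟩
  1                                ∎)
  where open ≡-Reasoning

15x²+49^[2y]≢16 : ∀ x y → y ≥ 1 → 15 * x ^ 2 + 49 ^ (2 * y) ≢ 16
15x²+49^[2y]≢16 x y y≥1 eq = <⇒≱ (toWitness {a? = 16 <? 49} tt) (begin
  49                          ≤⟨ ^-monoʳ-≤ 49 (≤-trans y≥1 (m≤m+n y (y + 0))) ⟩
  49 ^ (2 * y)                ≤⟨ m≤n+m (49 ^ (2 * y)) (15 * x ^ 2) ⟩
  15 * x ^ 2 + 49 ^ (2 * y)   ≡⟨ eq ⟩
  16                          ∎)
  where open ≤-Reasoning

lemma4p4 : ∀ (x y z : ℕ) → x ≥ 1 → y ≥ 1 → z ≥ 1 →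
    ¬ (15 * x ^ 2 + 49 ^ (2 * y) ≡ 2 ^ (z + 2))
lemma4p4 x y z _ y≥1 _ eq = case 15x²+49^[2y]≡2^n⇒4∣n x y (2 + z) eq′ of λ where
    (divides 0 ())
    (divides 1 2+z≡4) → 15x²+49^[2y]≢16 x y y≥1 (trans eq′ (cong (2 ^_) 2+z≡4))
    (divides (suc (suc k)) 2+z≡[2+k]*4) →
      15x²+Q²≢P² x {4 ^ (2 + k)} {49 ^ y} (coprime-^ {4} {49} (gcd≡1⇒coprime refl) (2 + k) y)
        (4^[2+k]%24≡16 k) (m%n≡1⇒m^k%n≡1 refl y) (begin
          15 * (x * x) + 49 ^ y * 49 ^ y  ≡⟨ cong₂ (λ a b → 15 * a + b) x^2≡x*x (m^[2n]≡m^n*m^n 49 y) ⟨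
          15 * x ^ 2 + 49 ^ (2 * y)       ≡⟨ eq′ ⟩
          2 ^ (2 + z)                     ≡⟨ cong (2 ^_) 2+z≡[2+k]*4 ⟩
          2 ^ ((2 + k) * 4)               ≡⟨ 2^[n*4]≡4^n*4^n (2 + k) ⟩
          4 ^ (2 + k) * 4 ^ (2 + k)       ∎)
  where
  open ≡-Reasoning
  eq′ : 15 * x ^ 2 + 49 ^ (2 * y) ≡ 2 ^ (2 + z)
  eq′ = trans eq (cong (2 ^_) (+-comm z 2))
  x^2≡x*x : x ^ 2 ≡ x * x
  x^2≡x*x = cong (x *_) (*-identityʳ x)
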